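{- Let $D$ be a bicolored directed cycle with a chord, let $B\subseteq V(D)$ be a bikernel of $D$, and let $C$ be its base cycle. If $(x,y,z)$ is a directed path in $C$ (on three vertices) such that $(x,y)$ has color $1$ and $(y,z)$ has color $2$, then $y\in B$.
   Context: A bicolored directed cycle with a chord is a digraph $D$ consisting of a directed cycle $C$ (the base cycle, obtained from $D$ by removing the chord) together with one additional arc (the chord) joining two non-consecutive vertices of $C$, with every arc colored $1$ or $2$. A non-empty $B\subseteq V(D)$ is a bikernel (by monochromatic paths) if: (i) for all distinct $u,v\in B$ there is no monochromatic directed $uv$-path; (ii) for every $v\in V(D)\setminus B$ there is a directed path of color $1$ from $v$ to a vertex of $B$; (iii) for every $v\in V(D)\setminus B$ there is a directed path of color $2$ from a vertex of $B$ to $v$. -}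

module Defs where

open import Data.Nat using (ℕ; suc)
open import Data.Nat.DivMod using (_mod_)
open import Data.Fin using (Fin; toℕ)
open import Data.Fin.Subset using (Subset; _∈_; _∉_; Nonempty)
open import Data.List using (List; []; _∷_)
open import Data.List.Relation.Unary.Unique.Propositional using (Unique)
open import Data.Product using (Σ; ∃; _×_)
open import Relation.Binary.PropositionalEquality using (_≡_; _≢_)
open import Relation.Nullary using (¬_)

data Color : Set where
  col1 col2 : Color

-- Vertices of the base cycle on n = suc k vertices are Fin (suc k);
-- the base cycle C has the arcs  i → next i  (indices mod n).
next : ∀ {k} → Fin (suc k) → Fin (suc k)
next {k} i = suc (toℕ i) mod (suc k)

record ChordedCycle (k : ℕ) : Set where
  field
    cycColor    : Fin (suc k) → Color   -- color of the cycle arc (i , next i)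
    chordTail   : Fin (suc k)
    chordHead   : Fin (suc k)
    chordColor  : Color
    tail≢head   : chordTail ≢ chordHead
    head≢next   : chordHead ≢ next chordTail
    tail≢next   : chordTail ≢ next chordHead

module _ {k : ℕ} (D : ChordedCycle k) where
  open ChordedCycle D

  V : Set
  V = Fin (suc k)

  data Arc (c : Color) : V → V → Set where
    cycArc   : ∀ {u} → cycColor u ≡ c → Arc c u (next u)
    chordArc : chordColor ≡ c → Arc c chordTail chordHead

  data Walk (c : Color) : V → V → Set where
    []  : ∀ {v} → Walk c v v
    _∷_ : ∀ {u w v} → Arc c u w → Walk c w v → Walk c u v

  verts : ∀ {c u v} → Walk c u v → List V
  verts {u = u} []       = u ∷ []
  verts {u = u} (_ ∷ p)  = u ∷ verts p

  MonoPath : Color → V → V → Set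
  MonoPath c u v = Σ (Walk c u v) (λ p → Unique (verts p))

  record IsBikernel (B : Subset (suc k)) : Set where
    field
      nonempty    : Nonempty B
      independent : ∀ u v → u ∈ B → v ∈ B → u ≢ v → ∀ c → ¬ MonoPath c u v
      absorbing1  : ∀ v → v ∉ B → ∃ λ b → b ∈ B × MonoPath col1 v b
      dominating2 : ∀ v → v ∉ B → ∃ λ b → b ∈ B × MonoPath col2 b v

-- Suppose y = next x is not in B. By (ii) a colour-1 path leaves y, and since the
-- cycle arc leaving y has colour 2, its first arc is the chord, of colour 1. By
-- (iii) a colour-2 path enters y, and since the cycle arc entering y has colour 1,
-- its last arc is the chord, of colour 2. The chord cannot have both colours.
module Submission where

open import Defs
open import Data.Nat using (ℕ; suc; _+_; _%_)
open import Data.Nat.Properties using (+-suc)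
open import Data.Nat.DivMod using (%-congˡ; %-distribˡ-+; m%n%n≡m%n; [m+n]%n≡m%n; m<n⇒m%n≡m; m%n<n)
open import Data.Fin using (Fin; toℕ)
open import Data.Fin.Properties using (toℕ-fromℕ<; toℕ<n; toℕ-injective)
open import Data.Fin.Subset using (Subset; _∈_; _∉_)
open import Data.Fin.Subset.Properties using (_∈?_)
open import Data.Product using (∃; _,_; proj₂)
open import Data.Sum using (_⊎_; inj₁; inj₂)
open import Data.Empty using (⊥; ⊥-elim)
open import Relation.Nullary.Decidable using (decidable-stable)
open import Relation.Binary.PropositionalEquality
  using (_≡_; _≢_; ≢-sym; refl; sym; trans; cong; subst; module ≡-Reasoning)

col1≢col2 : col1 ≢ col2
col1≢col2 ()

toℕ-next-back : ∀ {k} (i : Fin (suc k)) → (toℕ (next i) + k) % suc k ≡ toℕ i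
toℕ-next-back {k} i = begin
  (toℕ (next i) + k) % n             ≡⟨ cong (λ a → (a + k) % n) (toℕ-fromℕ< (m%n<n (suc m) n)) ⟩
  (suc m % n + k) % n                ≡⟨ %-distribˡ-+ (suc m % n) k n ⟩
  (suc m % n % n + k % n) % n        ≡⟨ %-congˡ (cong (_+ k % n) (m%n%n≡m%n (suc m) n)) ⟩
  (suc m % n + k % n) % n            ≡⟨ %-distribˡ-+ (suc m) k n ⟨
  (suc m + k) % n                    ≡⟨ %-congˡ (+-suc m k) ⟨
  (m + n) % n                        ≡⟨ [m+n]%n≡m%n m n ⟩
  m % n                              ≡⟨ m<n⇒m%n≡m (toℕ<n i) ⟩
  m                                  ∎
  where
  open ≡-Reasoning
  n = suc k
  m = toℕ i

next-injective : ∀ {k} {i j : Fin (suc k)} → next i ≡ next j → i ≡ j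
next-injective {k} {i} {j} e = toℕ-injective (begin
  toℕ i                        ≡⟨ toℕ-next-back i ⟨
  (toℕ (next i) + k) % suc k   ≡⟨ cong (λ v → (toℕ v + k) % suc k) e ⟩
  (toℕ (next j) + k) % suc k   ≡⟨ toℕ-next-back j ⟩
  toℕ j                        ∎)
  where open ≡-Reasoning

module _ {k : ℕ} (D : ChordedCycle k) where
  open ChordedCycle D

  arc-from-color : ∀ {c u w} → Arc D c u w → cycColor u ≡ c ⊎ chordColor ≡ c
  arc-from-color (cycArc e)   = inj₁ e
  arc-from-color (chordArc e) = inj₂ e

  arc-into-color : ∀ {c u v x} → Arc D c u v → v ≡ next x → cycColor x ≡ c ⊎ chordColor ≡ c
  arc-into-color {c} (cycArc e) v≡next = inj₁ (subst (λ w → cycColor w ≡ c) (next-injective v≡next) e)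
  arc-into-color (chordArc e) _ = inj₂ e

  first-arc : ∀ {c u v} → u ≢ v → Walk D c u v → ∃ λ w → Arc D c u w
  first-arc u≢u []      = ⊥-elim (u≢u refl)
  first-arc _   (a ∷ _) = _ , a

  last-arc : ∀ {c u v} → u ≢ v → Walk D c u v → ∃ λ w → Arc D c w v
  last-arc u≢u []      = ⊥-elim (u≢u refl)
  last-arc _   (a ∷ p) = last-arc-after a p
    where
    last-arc-after : ∀ {c u w v} → Arc D c u w → Walk D c w v → ∃ λ t → Arc D c t v
    last-arc-after a []      = _ , a
    last-arc-after _ (b ∷ p) = last-arc-after b p

  module _ {B : Subset (suc k)} (bikernel : IsBikernel D B) where
    open IsBikernel bikernel

    ∉-∈⇒≢ : ∀ {v b} → v ∉ B → b ∈ B → v ≢ b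
    ∉-∈⇒≢ v∉B b∈B refl = v∉B b∈B

    outside-leaves-in-color1 : ∀ {v} → v ∉ B → cycColor v ≡ col1 ⊎ chordColor ≡ col1
    outside-leaves-in-color1 {v} v∉B with absorbing1 v v∉B
    ... | b , b∈B , (p , _) = arc-from-color (proj₂ (first-arc (∉-∈⇒≢ v∉B b∈B) p))

    outside-entered-in-color2 : ∀ {x} → next x ∉ B → cycColor x ≡ col2 ⊎ chordColor ≡ col2
    outside-entered-in-color2 {x} y∉B with dominating2 (next x) y∉B
    ... | b , b∈B , (p , _) =
      arc-into-color (proj₂ (last-arc (≢-sym (∉-∈⇒≢ y∉B b∈B)) p)) refl

mainTheorem15 : (k : ℕ) (D : ChordedCycle k) (B : Subset (suc k)) →
    IsBikernel D B →
    (x : Fin (suc k)) →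
    ChordedCycle.cycColor D x ≡ col1 →
    ChordedCycle.cycColor D (next x) ≡ col2 →
    next x ∈ B
mainTheorem15 k D B bikernel x x↦col1 y↦col2 = decidable-stable (next x ∈? B) y∉B-absurd
  where
  open ChordedCycle D
  y∉B-absurd : next x ∉ B → ⊥
  y∉B-absurd y∉B with outside-leaves-in-color1 D bikernel y∉B | outside-entered-in-color2 D bikernel y∉B
  ... | inj₁ y↦col1 | _           = col1≢col2 (trans (sym y↦col1) y↦col2)
  ... | inj₂ _      | inj₁ x↦col2 = col1≢col2 (trans (sym x↦col1) x↦col2)
  ... | inj₂ chord1 | inj₂ chord2 = col1≢col2 (trans (sym chord1) chord2)
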